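{- Let $G$ be a finite $2$-group and $N$ a characteristic subgroup of $G$. If $G/N$ does not embed as a subgroup of index $2$ in any group generated by elements of order $2$, then $G$ does not embed as a subgroup of index $2$ in any group generated by elements of order $2$. -}

module Defs where

open import Level using (Level; _⊔_; suc)
open import Algebra.Bundles using (Group; RawGroup)
open import Algebra.Structures using (IsGroup)
open import Algebra.Morphism.Structures using (module GroupMorphisms)
import Algebra.Properties.Group as GroupProps
open import Data.Nat using (ℕ; _^_)
open import Data.Fin using (Fin)
open import Data.List using (List; foldr)
open import Data.List.Relation.Unary.All using (All)
open import Data.Product using (Σ; ∃; _×_; _,_; proj₁; proj₂)
open import Data.Sum using (_⊎_)
open import Relation.Nullary using (¬_)
open import Relation.Unary using (Pred)
open import Relation.Binary.PropositionalEquality using (_≡_)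
import Relation.Binary.Reasoning.Setoid as SetoidReasoning

module _ {a b ℓ₁ ℓ₂} (G : Group a ℓ₁) (H : Group b ℓ₂) where
  open GroupMorphisms (Group.rawGroup G) (Group.rawGroup H)

  IsEmbedding : (Group.Carrier G → Group.Carrier H) → Set (a ⊔ ℓ₁ ⊔ ℓ₂)
  IsEmbedding f = IsGroupMonomorphism f

module _ {a ℓ} (G : Group a ℓ) where
  open GroupMorphisms (Group.rawGroup G) (Group.rawGroup G)

  IsAutomorphism : (Group.Carrier G → Group.Carrier G) → Set (a ⊔ ℓ)
  IsAutomorphism f = IsGroupIsomorphism f

module _ {a ℓ} (G : Group a ℓ) where
  open Group G

  HasOrder : ℕ → Set (a ⊔ ℓ)
  HasOrder n = Σ (Fin n → Carrier) λ e →
                 (∀ i j → e i ≈ e j → i ≡ j) × (∀ x → ∃ λ i → e i ≈ x)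

  IsFinite2Group : Set (a ⊔ ℓ)
  IsFinite2Group = ∃ λ k → HasOrder (2 ^ k)

  HasOrder2 : Carrier → Set ℓ
  HasOrder2 x = (¬ (x ≈ ε)) × (x ∙ x ≈ ε)

  -- G is generated by its elements of order 2: every element is a finite
  -- product of elements of order 2 (these are self-inverse, so this is the
  -- subgroup they generate)
  GeneratedByInvolutions : Set (a ⊔ ℓ)
  GeneratedByInvolutions =
    ∀ g → ∃ λ (xs : List Carrier) → All HasOrder2 xs × (foldr _∙_ ε xs ≈ g)

  record IsSubgroup {p} (N : Pred Carrier p) : Set (a ⊔ ℓ ⊔ p) where
    field
      resp    : ∀ {x y} → x ≈ y → N x → N y
      ε∈      : N ε
      ∙-closed : ∀ {x y} → N x → N y → N (x ∙ y)
      ⁻¹-closed : ∀ {x} → N x → N (x ⁻¹)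

  record IsCharacteristic {p} (N : Pred Carrier p) : Set (a ⊔ ℓ ⊔ p) where
    field
      isSubgroup : IsSubgroup N
      invariant  : ∀ f → IsAutomorphism G f → ∀ {x} → N x → N (f x)
    open IsSubgroup isSubgroup public

  -- Conjugation is an automorphism, hence characteristic ⇒ normal

  open GroupProps G
  open SetoidReasoning setoid

  conj : Carrier → Carrier → Carrier
  conj g x = g ∙ x ∙ g ⁻¹

  private
    cancel-mid : ∀ g u v → u ∙ g ⁻¹ ∙ (g ∙ v) ≈ u ∙ v
    cancel-mid g u v = begin
      u ∙ g ⁻¹ ∙ (g ∙ v)   ≈⟨ assoc u (g ⁻¹) (g ∙ v) ⟩
      u ∙ (g ⁻¹ ∙ (g ∙ v)) ≈⟨ ∙-congˡ (sym (assoc (g ⁻¹) g v)) ⟩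
      u ∙ (g ⁻¹ ∙ g ∙ v)   ≈⟨ ∙-congˡ (∙-congʳ (inverseˡ g)) ⟩
      u ∙ (ε ∙ v)          ≈⟨ ∙-congˡ (identityˡ v) ⟩
      u ∙ v                ∎

    conj-homo : ∀ g x y → conj g (x ∙ y) ≈ conj g x ∙ conj g y
    conj-homo g x y = begin
      g ∙ (x ∙ y) ∙ g ⁻¹                 ≈⟨ ∙-congʳ (sym (assoc g x y)) ⟩
      g ∙ x ∙ y ∙ g ⁻¹                   ≈⟨ ∙-congʳ (sym (cancel-mid g (g ∙ x) y)) ⟩
      g ∙ x ∙ g ⁻¹ ∙ (g ∙ y) ∙ g ⁻¹      ≈⟨ assoc (g ∙ x ∙ g ⁻¹) (g ∙ y) (g ⁻¹) ⟩
      g ∙ x ∙ g ⁻¹ ∙ (g ∙ y ∙ g ⁻¹)      ∎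

    conj-ε : ∀ g → conj g ε ≈ ε
    conj-ε g = begin
      g ∙ ε ∙ g ⁻¹ ≈⟨ ∙-congʳ (identityʳ g) ⟩
      g ∙ g ⁻¹     ≈⟨ inverseʳ g ⟩
      ε            ∎

    conj-⁻¹ : ∀ g x → conj g (x ⁻¹) ≈ (conj g x) ⁻¹
    conj-⁻¹ g x = inverseʳ-unique (conj g x) (conj g (x ⁻¹)) (begin
      conj g x ∙ conj g (x ⁻¹) ≈⟨ sym (conj-homo g x (x ⁻¹)) ⟩
      conj g (x ∙ x ⁻¹)        ≈⟨ ∙-congʳ (∙-congˡ (inverseʳ x)) ⟩
      conj g ε                 ≈⟨ conj-ε g ⟩
      ε                        ∎)

    conj-inj : ∀ g {x y} → conj g x ≈ conj g y → x ≈ y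
    conj-inj g {x} {y} eq = ∙-cancelˡ g x y (∙-cancelʳ (g ⁻¹) (g ∙ x) (g ∙ y) eq)

    conj-back : ∀ g y → conj g (g ⁻¹ ∙ y ∙ g) ≈ y
    conj-back g y = begin
      g ∙ (g ⁻¹ ∙ y ∙ g) ∙ g ⁻¹   ≈⟨ ∙-congʳ (sym (assoc g (g ⁻¹ ∙ y) g)) ⟩
      g ∙ (g ⁻¹ ∙ y) ∙ g ∙ g ⁻¹   ≈⟨ assoc (g ∙ (g ⁻¹ ∙ y)) g (g ⁻¹) ⟩
      g ∙ (g ⁻¹ ∙ y) ∙ (g ∙ g ⁻¹) ≈⟨ ∙-congˡ (inverseʳ g) ⟩
      g ∙ (g ⁻¹ ∙ y) ∙ ε          ≈⟨ identityʳ _ ⟩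
      g ∙ (g ⁻¹ ∙ y)              ≈⟨ sym (assoc g (g ⁻¹) y) ⟩
      g ∙ g ⁻¹ ∙ y                ≈⟨ ∙-congʳ (inverseʳ g) ⟩
      ε ∙ y                       ≈⟨ identityˡ y ⟩
      y                           ∎

  conj-automorphism : ∀ g → IsAutomorphism G (conj g)
  conj-automorphism g = record
    { isGroupMonomorphism = record
      { isGroupHomomorphism = record
        { isMonoidHomomorphism = record
          { isMagmaHomomorphism = record
            { isRelHomomorphism = record { cong = λ eq → ∙-congʳ (∙-congˡ eq) }
            ; homo = conj-homo g
            }
          ; ε-homo = conj-ε g
          }
        ; ⁻¹-homo = conj-⁻¹ g
        }
      ; injective = conj-inj g
      }
    ; surjective = λ y → (g ⁻¹ ∙ y ∙ g) , λ {z} z≈ →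
        trans (∙-congʳ (∙-congˡ z≈)) (conj-back g y)
    }

  -- The quotient group G/N of G by a characteristic subgroup N:
  -- same carrier, with x ≈ y in G/N iff x ∙ y⁻¹ ∈ N.

  module Quotient {p} (N : Pred Carrier p) (ch : IsCharacteristic N) where
    open IsCharacteristic ch

    normal : ∀ g {x} → N x → N (conj g x)
    normal g = invariant (conj g) (conj-automorphism g)

    _≈N_ : Carrier → Carrier → Set p
    x ≈N y = N (x ∙ y ⁻¹)

    ≈⇒≈N : ∀ {x y} → x ≈ y → x ≈N y
    ≈⇒≈N eq = resp (sym (x≈y⇒x∙y⁻¹≈ε eq)) ε∈

    N-refl : ∀ {x} → x ≈N x
    N-refl = ≈⇒≈N refl

    N-sym : ∀ {x y} → x ≈N y → y ≈N x
    N-sym {x} {y} n = resp (begin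
      (x ∙ y ⁻¹) ⁻¹       ≈⟨ ⁻¹-anti-homo-∙ x (y ⁻¹) ⟩
      y ⁻¹ ⁻¹ ∙ x ⁻¹      ≈⟨ ∙-congʳ (⁻¹-involutive y) ⟩
      y ∙ x ⁻¹            ∎) (⁻¹-closed n)

    N-trans : ∀ {x y z} → x ≈N y → y ≈N z → x ≈N z
    N-trans {x} {y} {z} n m = resp (cancel-mid y x (z ⁻¹)) (∙-closed n m)

    N-∙-cong : ∀ {x x′ y y′} → x ≈N x′ → y ≈N y′ → (x ∙ y) ≈N (x′ ∙ y′)
    N-∙-cong {x} {x′} {y} {y′} n m = resp eq (∙-closed (normal x m) n)
      where
      eq : conj x (y ∙ y′ ⁻¹) ∙ (x ∙ x′ ⁻¹) ≈ x ∙ y ∙ (x′ ∙ y′) ⁻¹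
      eq = begin
        x ∙ (y ∙ y′ ⁻¹) ∙ x ⁻¹ ∙ (x ∙ x′ ⁻¹) ≈⟨ cancel-mid x (x ∙ (y ∙ y′ ⁻¹)) (x′ ⁻¹) ⟩
        x ∙ (y ∙ y′ ⁻¹) ∙ x′ ⁻¹             ≈⟨ ∙-congʳ (sym (assoc x y (y′ ⁻¹))) ⟩
        x ∙ y ∙ y′ ⁻¹ ∙ x′ ⁻¹               ≈⟨ assoc (x ∙ y) (y′ ⁻¹) (x′ ⁻¹) ⟩
        x ∙ y ∙ (y′ ⁻¹ ∙ x′ ⁻¹)             ≈⟨ ∙-congˡ (sym (⁻¹-anti-homo-∙ x′ y′)) ⟩
        x ∙ y ∙ (x′ ∙ y′) ⁻¹                ∎

    N-⁻¹-cong : ∀ {x y} → x ≈N y → (x ⁻¹) ≈N (y ⁻¹)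
    N-⁻¹-cong {x} {y} n = resp eq (normal (x ⁻¹) (N-sym n))
      where
      eq : conj (x ⁻¹) (y ∙ x ⁻¹) ≈ x ⁻¹ ∙ y ⁻¹ ⁻¹
      eq = begin
        x ⁻¹ ∙ (y ∙ x ⁻¹) ∙ x ⁻¹ ⁻¹  ≈⟨ ∙-congˡ (⁻¹-involutive x) ⟩
        x ⁻¹ ∙ (y ∙ x ⁻¹) ∙ x        ≈⟨ ∙-congʳ (sym (assoc (x ⁻¹) y (x ⁻¹))) ⟩
        x ⁻¹ ∙ y ∙ x ⁻¹ ∙ x          ≈⟨ assoc (x ⁻¹ ∙ y) (x ⁻¹) x ⟩
        x ⁻¹ ∙ y ∙ (x ⁻¹ ∙ x)        ≈⟨ ∙-congˡ (inverseˡ x) ⟩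
        x ⁻¹ ∙ y ∙ ε                 ≈⟨ identityʳ _ ⟩
        x ⁻¹ ∙ y                     ≈⟨ ∙-congˡ (sym (⁻¹-involutive y)) ⟩
        x ⁻¹ ∙ y ⁻¹ ⁻¹               ∎

    quotientGroup : Group a p
    quotientGroup = record
      { Carrier = Carrier
      ; _≈_ = _≈N_
      ; _∙_ = _∙_
      ; ε = ε
      ; _⁻¹ = _⁻¹
      ; isGroup = record
        { isMonoid = record
          { isSemigroup = record
            { isMagma = record
              { isEquivalence = record { refl = N-refl ; sym = N-sym ; trans = N-trans }
              ; ∙-cong = N-∙-cong
              }
            ; assoc = λ x y z → ≈⇒≈N (assoc x y z)
            }
          ; identity = (λ x → ≈⇒≈N (identityˡ x)) , (λ x → ≈⇒≈N (identityʳ x))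
          }
        ; inverse = (λ x → ≈⇒≈N (inverseˡ x)) , (λ x → ≈⇒≈N (inverseʳ x))
        ; ⁻¹-cong = N-⁻¹-cong
        }
      }

_/_∶_ : ∀ {a ℓ p} (G : Group a ℓ) (N : Pred (Group.Carrier G) p) →
        IsCharacteristic G N → Group a p
G / N ∶ ch = Quotient.quotientGroup G N ch

module _ {a b ℓ₁ ℓ₂} (G : Group a ℓ₁) (H : Group b ℓ₂) where
  open Group H

  InImage : (Group.Carrier G → Carrier) → Carrier → Set (a ⊔ ℓ₂)
  InImage f h = ∃ λ g → f g ≈ h

  ImageHasIndex2 : (Group.Carrier G → Carrier) → Set (a ⊔ b ⊔ ℓ₂)
  ImageHasIndex2 f = ∃ λ t → (¬ InImage f t) × (∀ h → InImage f h ⊎ InImage f (t ⁻¹ ∙ h))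

  EmbedsIndex2InInvolutionGenerated : Set (a ⊔ b ⊔ ℓ₁ ⊔ ℓ₂)
  EmbedsIndex2InInvolutionGenerated =
    GeneratedByInvolutions H ×
    Σ (Group.Carrier G → Carrier) λ f → IsEmbedding G H f × ImageHasIndex2 f

{-# OPTIONS --safe #-}

-- Let f : G ↪ H have index 2, with H generated by involutions. An index-2
-- subgroup is normal, so every conjugation of H restricts to an automorphism
-- of f(G) ≅ G; as N is characteristic, M = f(N) is therefore normal in H.
-- Then f induces an embedding G/N ↪ H/M, still of index 2, and H/M is
-- generated by the images of those involutions of H that are not in M.
-- Discarding the involutions in M needs membership in N to be decidable:
-- finiteness of G gives this under a double negation, which is harmless
-- because the conclusion is itself a negation.

module Submission where

open import Defs
open import Level using (_⊔_)
open import Algebra.Bundles using (Group)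
open import Algebra.Morphism.Structures using (module GroupMorphisms)
import Algebra.Morphism.Construct.Composition as Composition
import Algebra.Properties.Group as GroupProperties
open import Data.Empty using (⊥-elim)
open import Data.Fin using (Fin; zero; suc)
open import Data.List using ([]; _∷_; foldr)
open import Data.List.Relation.Unary.All using (All; []; _∷_)
open import Data.Nat using (ℕ)
open import Data.Product using (∃; _×_; _,_; proj₁; proj₂)
open import Data.Sum as Sum using (_⊎_; inj₁; inj₂)
open import Function using (_∘_)
open import Relation.Binary.Core using (Rel)
open import Relation.Binary.Structures using (IsEquivalence)
import Relation.Binary.Reasoning.Setoid as SetoidReasoning
open import Relation.Nullary using (¬_; yes; no)
open import Relation.Nullary.Decidable using (map′; decidable-stable; ¬¬-excluded-middle)
open import Relation.Unary using (Pred; Decidable)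

¬¬-decidable-Fin : ∀ n {p} (P : Pred (Fin n) p) → ¬ ¬ Decidable P
¬¬-decidable-Fin ℕ.zero    P k = k (λ ())
¬¬-decidable-Fin (ℕ.suc n) P k =
  ¬¬-excluded-middle λ P₀? →
  ¬¬-decidable-Fin n (P ∘ suc) λ Pₛ? →
  k λ { zero → P₀? ; (suc i) → Pₛ? i }

module _ {a ℓ} (G : Group a ℓ) where
  open Group G

  ¬¬-decidable : ∀ {n p} {P : Pred Carrier p} → HasOrder G n →
                 (∀ {x y} → x ≈ y → P x → P y) → ¬ ¬ Decidable P
  ¬¬-decidable {n} {P = P} (enum , _ , enum-onto) resp k =
    ¬¬-decidable-Fin n (P ∘ enum) λ P? →
    k λ x → let (i , enumᵢ≈x) = enum-onto x in
            map′ (resp enumᵢ≈x) (resp (sym enumᵢ≈x)) (P? i)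

module _ {b ℓ} (H : Group b ℓ) where
  open Group H
  open GroupProperties H

  conj-inverseˡ : ∀ h y → conj H (h ⁻¹) (conj H h y) ≈ y
  conj-inverseˡ h y = begin
    h ⁻¹ ∙ (h ∙ y ∙ h ⁻¹) ∙ h ⁻¹ ⁻¹  ≈⟨ ∙-cong (∙-congˡ (assoc h y (h ⁻¹))) (⁻¹-involutive h) ⟩
    h ⁻¹ ∙ (h ∙ (y ∙ h ⁻¹)) ∙ h      ≈⟨ ∙-congʳ (\\-leftDividesʳ h (y ∙ h ⁻¹)) ⟩
    y ∙ h ⁻¹ ∙ h                     ≈⟨ //-rightDividesˡ h y ⟩
    y                                ∎
    where open SetoidReasoning setoid

  module SubgroupProperties {p} {S : Pred Carrier p} (S-sub : IsSubgroup H S) where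
    open IsSubgroup S-sub

    ⁻¹-reflects : ∀ {x} → S (x ⁻¹) → S x
    ⁻¹-reflects x⁻¹∈S = resp (⁻¹-involutive _) (⁻¹-closed x⁻¹∈S)

    cancelˡ : ∀ {x y} → S x → S (x ∙ y) → S y
    cancelˡ {x} {y} x∈S xy∈S = resp (\\-leftDividesʳ x y) (∙-closed (⁻¹-closed x∈S) xy∈S)

    cancelʳ : ∀ {x y} → S y → S (x ∙ y) → S x
    cancelʳ {x} {y} y∈S xy∈S = resp (//-rightDividesʳ y x) (∙-closed xy∈S (⁻¹-closed y∈S))

  record IsNormalSubgroup {p} (M : Pred Carrier p) : Set (b ⊔ ℓ ⊔ p) where
    field
      isSubgroup : IsSubgroup H M
      normal     : ∀ g {x} → M x → M (conj H g x)
    open IsSubgroup isSubgroup public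

module NormalQuotient {b ℓ p} (H : Group b ℓ) {M : Pred (Group.Carrier H) p}
                      (M-normal : IsNormalSubgroup H M) where
  open Group H
  open GroupProperties H
  open IsNormalSubgroup M-normal
  open SetoidReasoning setoid

  infix 4 _≈M_
  _≈M_ : Rel Carrier p
  x ≈M y = M (x ∙ y ⁻¹)

  ≈⇒≈M : ∀ {x y} → x ≈ y → x ≈M y
  ≈⇒≈M x≈y = resp (sym (x≈y⇒x∙y⁻¹≈ε x≈y)) ε∈

  ≈M-isEquivalence : IsEquivalence _≈M_
  ≈M-isEquivalence = record
    { refl  = ≈⇒≈M refl
    ; sym   = λ {x} {y} x≈My → resp (⁻¹-anti-homo-// x y) (⁻¹-closed x≈My)
    ; trans = λ {x} {y} {z} x≈My y≈Mz → resp
        (trans (assoc x (y ⁻¹) (y ∙ z ⁻¹)) (∙-congˡ (\\-leftDividesʳ y (z ⁻¹))))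
        (∙-closed x≈My y≈Mz)
    }

  ∙-cong-M : ∀ {x x′ y y′} → x ≈M x′ → y ≈M y′ → x ∙ y ≈M x′ ∙ y′
  ∙-cong-M {x} {x′} {y} {y′} x≈Mx′ y≈My′ = resp eq (∙-closed (normal x y≈My′) x≈Mx′)
    where
    eq : x ∙ (y ∙ y′ ⁻¹) ∙ x ⁻¹ ∙ (x ∙ x′ ⁻¹) ≈ x ∙ y ∙ (x′ ∙ y′) ⁻¹
    eq = begin
      x ∙ (y ∙ y′ ⁻¹) ∙ x ⁻¹ ∙ (x ∙ x′ ⁻¹)  ≈⟨ assoc _ (x ⁻¹) _ ⟩
      x ∙ (y ∙ y′ ⁻¹) ∙ (x ⁻¹ ∙ (x ∙ x′ ⁻¹)) ≈⟨ ∙-cong (sym (assoc x y (y′ ⁻¹))) (\\-leftDividesʳ x (x′ ⁻¹)) ⟩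
      x ∙ y ∙ y′ ⁻¹ ∙ x′ ⁻¹                  ≈⟨ assoc (x ∙ y) (y′ ⁻¹) (x′ ⁻¹) ⟩
      x ∙ y ∙ (y′ ⁻¹ ∙ x′ ⁻¹)                ≈⟨ ∙-congˡ (⁻¹-anti-homo-∙ x′ y′) ⟨
      x ∙ y ∙ (x′ ∙ y′) ⁻¹                   ∎

  ⁻¹-cong-M : ∀ {x y} → x ≈M y → x ⁻¹ ≈M y ⁻¹
  ⁻¹-cong-M {x} {y} x≈My =
    resp (⁻¹-anti-homo-∙ (y ⁻¹) x) (⁻¹-closed (resp eq (normal (y ⁻¹) x≈My)))
    where
    eq : y ⁻¹ ∙ (x ∙ y ⁻¹) ∙ y ⁻¹ ⁻¹ ≈ y ⁻¹ ∙ x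
    eq = trans (∙-congʳ (sym (assoc (y ⁻¹) x (y ⁻¹)))) (//-rightDividesʳ (y ⁻¹) (y ⁻¹ ∙ x))

  quotient : Group b p
  quotient = record
    { Carrier = Carrier
    ; _≈_ = _≈M_
    ; _∙_ = _∙_
    ; ε = ε
    ; _⁻¹ = _⁻¹
    ; isGroup = record
      { isMonoid = record
        { isSemigroup = record
          { isMagma = record { isEquivalence = ≈M-isEquivalence ; ∙-cong = ∙-cong-M }
          ; assoc = λ x y z → ≈⇒≈M (assoc x y z)
          }
        ; identity = (λ x → ≈⇒≈M (identityˡ x)) , (λ x → ≈⇒≈M (identityʳ x))
        }
      ; inverse = (λ x → ≈⇒≈M (inverseˡ x)) , (λ x → ≈⇒≈M (inverseʳ x))
      ; ⁻¹-cong = ⁻¹-cong-M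
      }
    }

  private module Q = Group quotient

  x∙ε⁻¹≈x : ∀ x → x ∙ ε ⁻¹ ≈ x
  x∙ε⁻¹≈x x = trans (∙-congˡ ε⁻¹≈ε) (identityʳ x)

  involution : ∀ {x} → HasOrder2 H x → ¬ M x → HasOrder2 quotient x
  involution (_ , x∙x≈ε) x∉M = (λ x≈Mε → x∉M (resp (x∙ε⁻¹≈x _) x≈Mε)) , ≈⇒≈M x∙x≈ε

  module _ (M? : Decidable M) where

    dropTrivial : ∀ xs → All (HasOrder2 H) xs →
                  ∃ λ ys → All (HasOrder2 quotient) ys × foldr _∙_ ε ys ≈M foldr _∙_ ε xs
    dropTrivial []       []           = [] , [] , Q.refl
    dropTrivial (x ∷ xs) (x-inv ∷ xs-inv) with dropTrivial xs xs-inv | M? x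
    ... | ys , ys-inv , ys≈xs | yes x∈M =
      ys , ys-inv , Q.trans ys≈xs (Q.sym (Q.trans (Q.∙-congʳ x≈Mε) (Q.identityˡ _)))
      where
      x≈Mε : x ≈M ε
      x≈Mε = resp (sym (x∙ε⁻¹≈x x)) x∈M
    ... | ys , ys-inv , ys≈xs | no x∉M =
      x ∷ ys , involution x-inv x∉M ∷ ys-inv , Q.∙-congˡ ys≈xs

    generatedByInvolutions : GeneratedByInvolutions H → GeneratedByInvolutions quotient
    generatedByInvolutions gen h =
      let (xs , xs-inv , xs≈h) = gen h
          (ys , ys-inv , ys≈xs) = dropTrivial xs xs-inv
      in  ys , ys-inv , Q.trans ys≈xs (≈⇒≈M xs≈h)

_⧸_ : ∀ {b ℓ p} (H : Group b ℓ) {M : Pred (Group.Carrier H) p} →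
      IsNormalSubgroup H M → Group b p
H ⧸ M-normal = NormalQuotient.quotient H M-normal

module Index2 {b ℓ p} (H : Group b ℓ) {S : Pred (Group.Carrier H) p} (S-sub : IsSubgroup H S)
              {t : Group.Carrier H} (t∉S : ¬ S t)
              (cover : ∀ h → S h ⊎ S (Group._∙_ H (Group._⁻¹ H t) h)) where
  open Group H
  open GroupProperties H
  open IsSubgroup S-sub
  open SubgroupProperties H S-sub

  S? : Decidable S
  S? h with cover h
  ... | inj₁ h∈S    = yes h∈S
  ... | inj₂ t⁻¹h∈S = no λ h∈S → t∉S (⁻¹-reflects (cancelʳ h∈S t⁻¹h∈S))

  ∉⇒∈t⁻¹∙ : ∀ {h} → ¬ S h → S (t ⁻¹ ∙ h)
  ∉⇒∈t⁻¹∙ {h} h∉S with cover h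
  ... | inj₁ h∈S    = ⊥-elim (h∉S h∈S)
  ... | inj₂ t⁻¹h∈S = t⁻¹h∈S

  ∉-∉⇒∈ : ∀ {x y} → ¬ S x → ¬ S y → S (x ⁻¹ ∙ y)
  ∉-∉⇒∈ {x} {y} x∉S y∉S = resp eq (∙-closed (⁻¹-closed (∉⇒∈t⁻¹∙ x∉S)) (∉⇒∈t⁻¹∙ y∉S))
    where
    open SetoidReasoning setoid
    eq : (t ⁻¹ ∙ x) ⁻¹ ∙ (t ⁻¹ ∙ y) ≈ x ⁻¹ ∙ y
    eq = begin
      (t ⁻¹ ∙ x) ⁻¹ ∙ (t ⁻¹ ∙ y) ≈⟨ ∙-congʳ (⁻¹-anti-homo-\\ t x) ⟩
      x ⁻¹ ∙ t ∙ (t ⁻¹ ∙ y)      ≈⟨ assoc (x ⁻¹) t (t ⁻¹ ∙ y) ⟩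
      x ⁻¹ ∙ (t ∙ (t ⁻¹ ∙ y))    ≈⟨ ∙-congˡ (\\-leftDividesˡ t y) ⟩
      x ⁻¹ ∙ y                   ∎

  isNormalSubgroup : IsNormalSubgroup H S
  isNormalSubgroup = record { isSubgroup = S-sub ; normal = normal }
    where
    -- If h x h⁻¹ ∉ S then h ∉ S; both lie in the coset t S, so x h⁻¹ = h⁻¹ · h x h⁻¹ ∈ S and h ∈ S.
    normal : ∀ h {x} → S x → S (conj H h x)
    normal h {x} x∈S = decidable-stable (S? (conj H h x)) λ hxh⁻¹∉S →
      let h∉S : ¬ S h
          h∉S h∈S = hxh⁻¹∉S (∙-closed (∙-closed h∈S x∈S) (⁻¹-closed h∈S))
          eq : h ⁻¹ ∙ (h ∙ x ∙ h ⁻¹) ≈ x ∙ h ⁻¹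
          eq = trans (∙-congˡ (assoc h x (h ⁻¹))) (\\-leftDividesʳ h (x ∙ h ⁻¹))
      in  h∉S (⁻¹-reflects (cancelˡ x∈S (resp eq (∉-∉⇒∈ h∉S hxh⁻¹∉S))))

module _ {a b c ℓ₁ ℓ₂ ℓ₃} (K : Group c ℓ₃) (G : Group a ℓ₁) (H : Group b ℓ₂)
         {f : Group.Carrier G → Group.Carrier H} {g : Group.Carrier K → Group.Carrier H}
         (f-mono : IsEmbedding G H f) (g-mono : IsEmbedding K H g) where
  private
    module K = Group K
    module G = Group G
    module F = GroupMorphisms.IsGroupMonomorphism f-mono
    module g = GroupMorphisms.IsGroupMonomorphism g-mono
  open Group H
  open SetoidReasoning setoid

  cancelˡ-isEmbedding : ∀ {φ : K.Carrier → G.Carrier} → (∀ x → f (φ x) ≈ g x) → IsEmbedding K G φ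
  cancelˡ-isEmbedding {φ} f∘φ≈g = record
    { isGroupHomomorphism = record
      { isMonoidHomomorphism = record
        { isMagmaHomomorphism = record
          { isRelHomomorphism = record { cong = λ {x} {y} x≈y → F.injective (begin
              f (φ x) ≈⟨ f∘φ≈g x ⟩
              g x     ≈⟨ g.⟦⟧-cong x≈y ⟩
              g y     ≈⟨ f∘φ≈g y ⟨
              f (φ y) ∎) }
          ; homo = λ x y → F.injective (begin
              f (φ (x K.∙ y))     ≈⟨ f∘φ≈g (x K.∙ y) ⟩
              g (x K.∙ y)         ≈⟨ g.∙-homo x y ⟩
              g x ∙ g y           ≈⟨ ∙-cong (f∘φ≈g x) (f∘φ≈g y) ⟨
              f (φ x) ∙ f (φ y)   ≈⟨ F.∙-homo (φ x) (φ y) ⟨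
              f (φ x G.∙ φ y)     ∎)
          }
        ; ε-homo = F.injective (begin
            f (φ K.ε) ≈⟨ f∘φ≈g K.ε ⟩
            g K.ε     ≈⟨ g.ε-homo ⟩
            ε         ≈⟨ F.ε-homo ⟨
            f G.ε     ∎)
        }
      ; ⁻¹-homo = λ x → F.injective (begin
          f (φ (x K.⁻¹))  ≈⟨ f∘φ≈g (x K.⁻¹) ⟩
          g (x K.⁻¹)      ≈⟨ g.⁻¹-homo x ⟩
          g x ⁻¹          ≈⟨ ⁻¹-cong (f∘φ≈g x) ⟨
          f (φ x) ⁻¹      ≈⟨ F.⁻¹-homo (φ x) ⟨
          f (φ x G.⁻¹)    ∎)
      }
    ; injective = λ {x} {y} φx≈φy → g.injective (begin
        g x     ≈⟨ f∘φ≈g x ⟨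
        f (φ x) ≈⟨ F.⟦⟧-cong φx≈φy ⟩
        f (φ y) ≈⟨ f∘φ≈g y ⟩
        g y     ∎)
    }

module Embedding {a b ℓ₁ ℓ₂} (G : Group a ℓ₁) (H : Group b ℓ₂)
                 {f : Group.Carrier G → Group.Carrier H} (f-mono : IsEmbedding G H f) where
  private
    module G = Group G
    module F = GroupMorphisms.IsGroupMonomorphism f-mono
  open Group H
  open SetoidReasoning setoid

  Im : Pred Carrier (a ⊔ ℓ₂)
  Im = InImage G H f

  Im-isSubgroup : IsSubgroup H Im
  Im-isSubgroup = record
    { resp      = λ { y≈z (g , fg≈y) → g , trans fg≈y y≈z }
    ; ε∈        = G.ε , F.ε-homo
    ; ∙-closed  = λ { (g , fg≈x) (g′ , fg′≈y) → g G.∙ g′ , trans (F.∙-homo g g′) (∙-cong fg≈x fg′≈y) }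
    ; ⁻¹-closed = λ { (g , fg≈x) → g G.⁻¹ , trans (F.⁻¹-homo g) (⁻¹-cong fg≈x) }
    }

  Image : ∀ {p} → Pred G.Carrier p → Pred Carrier (a ⊔ p ⊔ ℓ₂)
  Image N h = ∃ λ g → N g × f g ≈ h

  Image⇒Im : ∀ {p} {N : Pred G.Carrier p} {h} → Image N h → Im h
  Image⇒Im (g , _ , fg≈h) = g , fg≈h

  Image-isSubgroup : ∀ {p} {N : Pred G.Carrier p} → IsSubgroup G N → IsSubgroup H (Image N)
  Image-isSubgroup N-sub = record
    { resp      = λ { y≈z (g , Ng , fg≈y) → g , Ng , trans fg≈y y≈z }
    ; ε∈        = G.ε , N.ε∈ , F.ε-homo
    ; ∙-closed  = λ { (g , Ng , fg≈x) (g′ , Ng′ , fg′≈y) →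
        g G.∙ g′ , N.∙-closed Ng Ng′ , trans (F.∙-homo g g′) (∙-cong fg≈x fg′≈y) }
    ; ⁻¹-closed = λ { (g , Ng , fg≈x) → g G.⁻¹ , N.⁻¹-closed Ng , trans (F.⁻¹-homo g) (⁻¹-cong fg≈x) }
    }
    where module N = IsSubgroup N-sub

  Image-decidable : ∀ {p} {N : Pred G.Carrier p} → (∀ {x y} → x G.≈ y → N x → N y) →
                    Decidable Im → Decidable N → Decidable (Image N)
  Image-decidable N-resp Im? N? h with Im? h
  ... | no h∉Im        = no λ h∈fN → h∉Im (Image⇒Im h∈fN)
  ... | yes (g , fg≈h) = map′ (λ Ng → g , Ng , fg≈h)
                              (λ { (g′ , Ng′ , fg′≈h) → N-resp (F.injective (trans fg′≈h (sym fg≈h))) Ng′ })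
                              (N? g)

  module Restriction {α : Carrier → Carrier} (α-auto : IsAutomorphism H α)
                     (α-preserves : ∀ {y} → Im y → Im (α y))
                     (α-reflects : ∀ {y} → Im (α y) → Im y) where
    private module α = GroupMorphisms.IsGroupIsomorphism α-auto

    restriction : G.Carrier → G.Carrier
    restriction x = proj₁ (α-preserves (x , refl))

    f∘restriction≈α∘f : ∀ x → f (restriction x) ≈ α (f x)
    f∘restriction≈α∘f x = proj₂ (α-preserves (x , refl))

    restriction-automorphism : IsAutomorphism G restriction
    restriction-automorphism = record
      { isGroupMonomorphism = cancelˡ-isEmbedding G G H f-mono α∘f-mono f∘restriction≈α∘f
      ; surjective = onto
      }
      where
      α∘f-mono : IsEmbedding G H (α ∘ f)
      α∘f-mono = Composition.isGroupMonomorphism trans f-mono α.isGroupMonomorphism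

      onto : ∀ y → ∃ λ x → ∀ {z} → z G.≈ x → restriction z G.≈ y
      onto y =
        let (z , αz≈fy) = α.surjective (f y)
            (x , fx≈z)  = α-reflects (y , sym (αz≈fy refl))
        in  x , λ {x′} x′≈x → F.injective (begin
              f (restriction x′) ≈⟨ f∘restriction≈α∘f x′ ⟩
              α (f x′)           ≈⟨ αz≈fy (trans (F.⟦⟧-cong x′≈x) fx≈z) ⟩
              f y                ∎)

  Image-normal : ∀ {p} {N : Pred G.Carrier p} → IsNormalSubgroup H Im →
                 IsCharacteristic G N → IsNormalSubgroup H (Image N)
  Image-normal Im-normal N-char = record
    { isSubgroup = Image-isSubgroup N.isSubgroup
    ; normal     = λ { h (n , Nn , fn≈y) →
        let open Restriction (conj-automorphism H h) (Im.normal h) (reflects h)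
        in  restriction n , N.invariant restriction restriction-automorphism Nn ,
            trans (f∘restriction≈α∘f n) (∙-congʳ (∙-congˡ fn≈y)) }
    }
    where
    module Im = IsNormalSubgroup Im-normal
    module N = IsCharacteristic N-char
    reflects : ∀ h {y} → Im (conj H h y) → Im y
    reflects h {y} = Im.resp (conj-inverseˡ H h y) ∘ Im.normal (h ⁻¹)

module QuotientEmbedding {a b ℓ₁ ℓ₂ p} (G : Group a ℓ₁) (H : Group b ℓ₂)
                         {f : Group.Carrier G → Group.Carrier H} (f-mono : IsEmbedding G H f)
                         {N : Pred (Group.Carrier G) p} (N-char : IsCharacteristic G N)
                         (Im-normal : IsNormalSubgroup H (InImage G H f)) where
  private
    module G = Group G
    module F = GroupMorphisms.IsGroupMonomorphism f-mono
    module N = IsCharacteristic N-char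
  open Group H
  open Embedding G H f-mono
  open SubgroupProperties H Im-isSubgroup

  fN-normal : IsNormalSubgroup H (Image N)
  fN-normal = Image-normal Im-normal N-char

  open NormalQuotient H fN-normal using (≈⇒≈M)

  f-// : ∀ x y → f (x G.∙ y G.⁻¹) ≈ f x ∙ f y ⁻¹
  f-// x y = trans (F.∙-homo x (y G.⁻¹)) (∙-congˡ (F.⁻¹-homo y))

  quotient-isEmbedding : IsEmbedding (G / N ∶ N-char) (H ⧸ fN-normal) f
  quotient-isEmbedding = record
    { isGroupHomomorphism = record
      { isMonoidHomomorphism = record
        { isMagmaHomomorphism = record
          { isRelHomomorphism = record { cong = λ {x} {y} Nxy⁻¹ → x G.∙ y G.⁻¹ , Nxy⁻¹ , f-// x y }
          ; homo = λ x y → ≈⇒≈M (F.∙-homo x y)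
          }
        ; ε-homo = ≈⇒≈M F.ε-homo
        }
      ; ⁻¹-homo = λ x → ≈⇒≈M (F.⁻¹-homo x)
      }
    ; injective = λ { {x} {y} (g , Ng , fg≈) → N.resp (F.injective (trans fg≈ (sym (f-// x y)))) Ng }
    }

  quotient-index2 : ImageHasIndex2 G H f → ImageHasIndex2 (G / N ∶ N-char) (H ⧸ fN-normal) f
  quotient-index2 (t , t∉Im , cover) = t , t∉Im′ , Sum.map lift lift ∘ cover
    where
    lift : ∀ {h} → Im h → InImage (G / N ∶ N-char) (H ⧸ fN-normal) f h
    lift (g , fg≈h) = g , ≈⇒≈M fg≈h
    t∉Im′ : ¬ InImage (G / N ∶ N-char) (H ⧸ fN-normal) f t
    t∉Im′ (g , fg≈Mt) = t∉Im (⁻¹-reflects (cancelˡ (g , refl) (Image⇒Im fg≈Mt)))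

lemma1 : ∀ {a ℓ p} (G : Group a ℓ) (N : Pred (Group.Carrier G) p) →
    IsFinite2Group G →
    (ch : IsCharacteristic G N) →
    (∀ {b ℓ′} (H : Group b ℓ′) → ¬ EmbedsIndex2InInvolutionGenerated (G / N ∶ ch) H) →
    ∀ {b ℓ′} (H : Group b ℓ′) → ¬ EmbedsIndex2InInvolutionGenerated G H
lemma1 G N (_ , G-finite) N-char G/N-not-embeddable H
       (H-gen , f , f-mono , f-index2@(_ , t∉Im , cover)) =
  ¬¬-decidable G G-finite N.resp λ N? →
  G/N-not-embeddable (H ⧸ fN-normal)
    ( generatedByInvolutions (Image-decidable N.resp Im? N?) H-gen
    , f , quotient-isEmbedding , quotient-index2 f-index2 )
  where
  module N = IsCharacteristic N-char
  open Embedding G H f-mono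
  open Index2 H Im-isSubgroup t∉Im cover
    renaming (S? to Im?; isNormalSubgroup to Im-normal)
  open QuotientEmbedding G H f-mono N-char Im-normal
  open NormalQuotient H fN-normal using (generatedByInvolutions)
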